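{- Let $q$ be a prime power and let $\mathcal{C}\subseteq\mathrm{Alt}_n(\mathbb{F}_q)$ be an $\mathbb{F}_q$-linear subspace of dimension $k$ with minimum rank distance $2d$. Then $$k\leq\frac{n(n-1)-2(d-1)(2d-1)}{2}.$$
   Context: $\mathrm{Alt}_n(\mathbb{F}_q)$ is the $\mathbb{F}_q$-space of $n\times n$ alternating matrices over $\mathbb{F}_q$ (i.e. $A=-A^\top$ with zero diagonal), of dimension $n(n-1)/2$, endowed with the rank distance $\mathrm{rk}(A-B)$. The minimum rank distance of a code $\mathcal{C}$ (with at least two elements) is $\min\{\mathrm{rk}(A-B): A,B\in\mathcal{C}, A\neq B\}$; it is always even for alternating codes. -}

module Defs where

open import Level using (Level; _⊔_)
open import Data.Nat using (ℕ; zero; suc)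
open import Data.Fin using (Fin)
import Data.Fin as F
open import Data.Product using (Σ; ∃; _×_; _,_)
open import Data.Nat.Primality using (Prime)
open import Relation.Binary.PropositionalEquality using (_≡_)
open import Relation.Nullary using (¬_)
open import Algebra.Bundles using (CommutativeRing)
import Data.Nat as N

record IsField {c ℓ} (R : CommutativeRing c ℓ) : Set (c ⊔ ℓ) where
  open CommutativeRing R
  field
    1≉0 : ¬ (1# ≈ 0#)
    inverse : ∀ x → ¬ (x ≈ 0#) → ∃ λ y → x * y ≈ 1#

IsPrimePower : ℕ → Set
IsPrimePower q = ∃ λ p → ∃ λ m → Prime p × (1 N.≤ m) × (q ≡ p N.^ m)

module _ {c ℓ} (R : CommutativeRing c ℓ) where
  open CommutativeRing R

  HasCardinality : ℕ → Set (c ⊔ ℓ)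
  HasCardinality q = Σ (Fin q → Carrier) λ e →
    (∀ x → ∃ λ i → e i ≈ x) × (∀ i j → e i ≈ e j → i ≡ j)

  ∑ : ∀ {m} → (Fin m → Carrier) → Carrier
  ∑ {zero}  f = 0#
  ∑ {suc m} f = f F.zero + ∑ (λ i → f (F.suc i))

  Vector : ℕ → Set c
  Vector n = Fin n → Carrier

  Matrix : ℕ → Set c
  Matrix n = Fin n → Fin n → Carrier

  LinIndep : ∀ {r n} → (Fin r → Vector n) → Set (c ⊔ ℓ)
  LinIndep {r} {n} v = ∀ (a : Fin r → Carrier) →
    (∀ j → ∑ (λ i → a i * v i j) ≈ 0#) → ∀ i → a i ≈ 0#

  HasRank : ∀ {n} → Matrix n → ℕ → Set (c ⊔ ℓ)
  HasRank {n} A r =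
    (∃ λ (σ : Fin r → Fin n) → LinIndep (λ i → A (σ i))) ×
    (∀ (σ : Fin (suc r) → Fin n) → ¬ LinIndep (λ i → A (σ i)))

  IsAlternating : ∀ {n} → Matrix n → Set ℓ
  IsAlternating A = (∀ i j → A i j ≈ - A j i) × (∀ i → A i i ≈ 0#)

  MatEq : ∀ {n} → Matrix n → Matrix n → Set ℓ
  MatEq A B = ∀ i j → A i j ≈ B i j

  _-ᴹ_ : ∀ {n} → Matrix n → Matrix n → Matrix n
  (A -ᴹ B) i j = A i j - B i j

  LinIndepᴹ : ∀ {k n} → (Fin k → Matrix n) → Set (c ⊔ ℓ)
  LinIndepᴹ {k} B = ∀ (a : Fin k → Carrier) →
    (∀ i j → ∑ (λ l → a l * B l i j) ≈ 0#) → ∀ l → a l ≈ 0#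

  comb : ∀ {k n} → (Fin k → Matrix n) → (Fin k → Carrier) → Matrix n
  comb B a i j = ∑ (λ l → a l * B l i j)

  -- The code C = span of B (an F-subspace of Alt_n of dimension k when B is a
  -- linearly independent family of alternating matrices).
  -- A ∈ C  iff  A = comb B a for some coefficient vector a.
  InSpan : ∀ {k n} → (Fin k → Matrix n) → Matrix n → Set (c ⊔ ℓ)
  InSpan B A = ∃ λ a → MatEq A (comb B a)

  MinRankDistance : ∀ {k n} → (Fin k → Matrix n) → ℕ → Set (c ⊔ ℓ)
  MinRankDistance B δ =
    (∀ A A' → InSpan B A → InSpan B A' → ¬ MatEq A A' →
       ∀ r → HasRank (A -ᴹ A') r → δ N.≤ r) ×
    (∃ λ A → ∃ λ A' → InSpan B A × InSpan B A' × ¬ MatEq A A' ×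
       HasRank (A -ᴹ A') δ)

-- Puncture the code on the strictly upper triangular positions (i , j) with j ≥ 2d − 1.
-- If two codewords agree there, their difference is alternating and vanishes outside
-- its leading (2d − 1) × (2d − 1) block, so its rank is below 2d and the codewords
-- coincide.  The puncturing map is thus injective, whence q ^ k ≤ q ^ N for the
-- number N = n(n − 1)/2 − (d − 1)(2d − 1) of these positions.
module Submission where

open import Defs
open import Level using (Level)
open import Data.Nat using (ℕ; _+_; _*_; _∸_; _≤_)
open import Data.Fin using (Fin)
open import Data.Product using (_×_)
open import Algebra.Bundles using (CommutativeRing)

open import Level using (_⊔_)
open import Data.Nat using (zero; suc; _<_; nonTrivial⇒n>1; _^_; _≤′_; ≤′-refl; ≤′-step; z≤n; _≤?_)
import Data.Nat.Properties as ℕₚ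
open import Data.Nat.Primality using (prime⇒nonTrivial)
open import Data.Nat.Tactic.RingSolver using (solve-∀)
open import Data.Fin using (zero; suc; toℕ; fromℕ; fromℕ<; inject₁; inject≤; _↑ˡ_; _↑ʳ_; splitAt; funToFin; finToFun; combine)
import Data.Fin.Properties as Finₚ
open import Data.Product using (∃; _,_; proj₁; proj₂; map; uncurry)
open import Data.Sum using ([_,_]′; inj₁; inj₂)
open import Data.Empty using (⊥-elim)
open import Function using (_∘_)
open import Relation.Nullary using (¬_; yes; no; contradiction)
open import Relation.Nullary.Decidable using (decidable-stable; ¬¬-excluded-middle)
open import Relation.Nullary.Negation using (¬¬-map)
open import Relation.Binary using (tri<; tri≈; tri>)
open import Relation.Binary.PropositionalEquality
  using (_≡_; _≢_; refl; sym; trans; cong; cong₂; subst; module ≡-Reasoning)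
open import Data.Maybe using (nothing)
open import Tactic.RingSolver.Core.AlmostCommutativeRing using (fromCommutativeRing)

triangle : ℕ → ℕ
triangle zero    = 0
triangle (suc n) = triangle n + n

2*triangle : ∀ n → 2 * triangle n ≡ n * (n ∸ 1)
2*triangle zero          = refl
2*triangle (suc zero)    = refl
2*triangle (suc (suc n)) = begin
  2 * (triangle (suc n) + suc n)    ≡⟨ ℕₚ.*-distribˡ-+ 2 (triangle (suc n)) (suc n) ⟩
  2 * triangle (suc n) + 2 * suc n  ≡⟨ cong (_+ 2 * suc n) (2*triangle (suc n)) ⟩
  suc n * n + 2 * suc n             ≡⟨ step n ⟩
  suc (suc n) * suc n               ∎
  where
  open ≡-Reasoning
  step : ∀ n → suc n * n + 2 * suc n ≡ suc (suc n) * suc n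
  step = solve-∀

triangle-odd : ∀ d → (d ∸ 1) * (2 * d ∸ 1) ≡ triangle (2 * d ∸ 1)
triangle-odd d = ℕₚ.*-cancelˡ-≡ _ _ 2 (trans (double d) (sym (2*triangle (2 * d ∸ 1))))
  where
  square : ∀ d → 2 * (d * suc (2 * d)) ≡ suc (2 * d) * (2 * d)
  square = solve-∀
  double : ∀ d → 2 * ((d ∸ 1) * (2 * d ∸ 1)) ≡ (2 * d ∸ 1) * (2 * d ∸ 1 ∸ 1)
  double zero = refl
  double (suc d) = begin
    2 * (d * (2 * suc d ∸ 1))      ≡⟨ cong (λ t → 2 * (d * t)) odd ⟩
    2 * (d * suc (2 * d))          ≡⟨ square d ⟩
    suc (2 * d) * (2 * d)          ≡⟨ cong (λ t → t * (t ∸ 1)) odd ⟨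
    (2 * suc d ∸ 1) * (2 * suc d ∸ 1 ∸ 1) ∎
    where
    open ≡-Reasoning
    odd : 2 * suc d ∸ 1 ≡ suc (2 * d)
    odd = cong (_∸ 1) (ℕₚ.*-suc 2 d)

outerColumn : ℕ → ℕ → ℕ
outerColumn s j with s ≤? j
... | yes _ = j
... | no  _ = 0

outerColumn-≤ : ∀ s j → outerColumn s j ≤ j
outerColumn-≤ s j with s ≤? j
... | yes _ = ℕₚ.≤-refl
... | no  _ = z≤n

outerColumn-≥ : ∀ {s j} → s ≤ j → outerColumn s j ≡ j
outerColumn-≥ {s} {j} s≤j with s ≤? j
... | yes _   = refl
... | no  s≰j = contradiction s≤j s≰j

outerColumn-< : ∀ {s j} → j < s → outerColumn s j ≡ 0
outerColumn-< {s} {j} j<s with s ≤? j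
... | yes s≤j = contradiction s≤j (ℕₚ.<⇒≱ j<s)
... | no  _   = refl

-- The positions (i , j) with i < j < n and s ≤ j: the strict upper triangle of an
-- n × n matrix without that of its leading s × s block.
outerSize : ℕ → ℕ → ℕ
outerSize s zero    = 0
outerSize s (suc n) = outerSize s n + outerColumn s n

outerSize-≤ : ∀ {s n} → n ≤ s → outerSize s n ≡ 0
outerSize-≤ {n = zero}  _     = refl
outerSize-≤ {n = suc n} n<s
  rewrite outerSize-≤ (ℕₚ.<⇒≤ n<s) | outerColumn-< n<s = refl

outerSize+triangle : ∀ {s n} → s ≤ n → outerSize s n + triangle s ≡ triangle n
outerSize+triangle s≤n = go (ℕₚ.≤⇒≤′ s≤n)
  where
  go : ∀ {s n} → s ≤′ n → outerSize s n + triangle s ≡ triangle n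
  go {s} ≤′-refl = cong (_+ triangle s) (outerSize-≤ {s} ℕₚ.≤-refl)
  go {s} {suc n} (≤′-step s≤′n) = begin
    outerSize s n + outerColumn s n + triangle s  ≡⟨ cong (λ c → outerSize s n + c + triangle s) (outerColumn-≥ (ℕₚ.≤′⇒≤ s≤′n)) ⟩
    outerSize s n + n + triangle s                ≡⟨ swap (outerSize s n) n (triangle s) ⟩
    outerSize s n + triangle s + n                ≡⟨ cong (_+ n) (go s≤′n) ⟩
    triangle n + n                                ∎
    where
    open ≡-Reasoning
    swap : ∀ a b c → a + b + c ≡ a + c + b
    swap = solve-∀

outerPosition : ∀ s n → Fin (outerSize s n) → Fin n × Fin n
outerPosition s (suc n) =
  [ map inject₁ inject₁ ∘ outerPosition s n
  , (λ i → inject₁ (inject≤ i (outerColumn-≤ s n)) , fromℕ n)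
  ]′ ∘ splitAt (outerSize s n)

outerPosition-↑ˡ : ∀ s n (p : Fin (outerSize s n)) →
  outerPosition s (suc n) (p ↑ˡ outerColumn s n) ≡ map inject₁ inject₁ (outerPosition s n p)
outerPosition-↑ˡ s n p = cong [ _ , _ ]′ (Finₚ.splitAt-↑ˡ (outerSize s n) p (outerColumn s n))

outerPosition-↑ʳ : ∀ s n (i : Fin (outerColumn s n)) →
  outerPosition s (suc n) (outerSize s n ↑ʳ i) ≡ (inject₁ (inject≤ i (outerColumn-≤ s n)) , fromℕ n)
outerPosition-↑ʳ s n i = cong [ _ , _ ]′ (Finₚ.splitAt-↑ʳ (outerSize s n) (outerColumn s n) i)

outerPosition-covers : ∀ s n {i j} → i < j → j < n → s ≤ j →
  ∃ λ p → map toℕ toℕ (outerPosition s n p) ≡ (i , j)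
outerPosition-covers s (suc n) {i} {j} i<j j<1+n s≤j with ℕₚ.m<1+n⇒m<n∨m≡n j<1+n
... | inj₁ j<n with outerPosition-covers s n i<j j<n s≤j
...   | p , covered = p ↑ˡ outerColumn s n , (begin
  map toℕ toℕ (outerPosition s (suc n) (p ↑ˡ outerColumn s n))  ≡⟨ cong (map toℕ toℕ) (outerPosition-↑ˡ s n p) ⟩
  map toℕ toℕ (map inject₁ inject₁ (outerPosition s n p))       ≡⟨ cong₂ _,_ (Finₚ.toℕ-inject₁ _) (Finₚ.toℕ-inject₁ _) ⟩
  map toℕ toℕ (outerPosition s n p)                             ≡⟨ covered ⟩
  (i , j)                                                       ∎)
  where open ≡-Reasoning
outerPosition-covers s (suc n) {i} i<j _ s≤j | inj₂ refl = outerSize s n ↑ʳ i′ , (begin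
  map toℕ toℕ (outerPosition s (suc n) (outerSize s n ↑ʳ i′))  ≡⟨ cong (map toℕ toℕ) (outerPosition-↑ʳ s n i′) ⟩
  (toℕ (inject₁ (inject≤ i′ _)) , toℕ (fromℕ n))               ≡⟨ cong₂ _,_ toℕ-i′ (Finₚ.toℕ-fromℕ n) ⟩
  (i , n)                                                      ∎)
  where
  open ≡-Reasoning
  i<column : i < outerColumn s n
  i<column = subst (i <_) (sym (outerColumn-≥ s≤j)) i<j
  i′ : Fin (outerColumn s n)
  i′ = fromℕ< i<column
  toℕ-i′ : toℕ (inject₁ (inject≤ i′ (outerColumn-≤ s n))) ≡ i
  toℕ-i′ = trans (Finₚ.toℕ-inject₁ _) (trans (Finₚ.toℕ-inject≤ _ _) (Finₚ.toℕ-fromℕ< i<column))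

outerPosition-surjective : ∀ s n (i j : Fin n) → toℕ i < toℕ j → s ≤ toℕ j →
  ∃ λ p → outerPosition s n p ≡ (i , j)
outerPosition-surjective s n i j i<j s≤j with outerPosition-covers s n i<j (Finₚ.toℕ<n j) s≤j
... | p , covered = p , cong₂ _,_ (Finₚ.toℕ-injective (cong proj₁ covered))
                                  (Finₚ.toℕ-injective (cong proj₂ covered))

primePower>1 : ∀ {q} → IsPrimePower q → 1 < q
primePower>1 (p , m , p-prime , 1≤m , refl) =
  ℕₚ.^-monoʳ-< p (nonTrivial⇒n>1 p {{prime⇒nonTrivial p-prime}}) 1≤m

^-cancelˡ-≤ : ∀ {q m n} → 1 < q → q ^ m ≤ q ^ n → m ≤ n
^-cancelˡ-≤ {q} 1<q qᵐ≤qⁿ = ℕₚ.≮⇒≥ (λ n<m → ℕₚ.<⇒≱ (ℕₚ.^-monoʳ-< q 1<q n<m) qᵐ≤qⁿ)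

funToFin-cong : ∀ {m n} {f g : Fin m → Fin n} → (∀ i → f i ≡ g i) → funToFin f ≡ funToFin g
funToFin-cong {zero}      _   = refl
funToFin-cong {suc m} {n} f≗g = cong₂ (combine {n} {n ^ m}) (f≗g zero) (funToFin-cong (f≗g ∘ suc))

module _ {c ℓ} (R : CommutativeRing c ℓ) where
  open CommutativeRing R hiding (zero) renaming (_+_ to _+ᴿ_; _*_ to _*ᴿ_; refl to ≈-refl; sym to ≈-sym; trans to ≈-trans)
  open import Algebra.Properties.Ring ring using (-0#≈0#; -‿+-comm; -‿distribʳ-*; x∙y⁻¹≈ε⇒x≈y; x≈y⇒x∙y⁻¹≈ε; [y-z]x≈yx-zx)
  open import Tactic.RingSolver.NonReflective (fromCommutativeRing R (λ _ → nothing))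
    using (solve; _⊜_; _⊕_; ⊝_)

  ∑-cong : ∀ {m} {f g : Fin m → Carrier} → (∀ i → f i ≈ g i) → ∑ R f ≈ ∑ R g
  ∑-cong {zero}  _   = ≈-refl
  ∑-cong {suc m} f≈g = +-cong (f≈g zero) (∑-cong (f≈g ∘ suc))

  ∑-0 : ∀ {m} {f : Fin m → Carrier} → (∀ i → f i ≈ 0#) → ∑ R f ≈ 0#
  ∑-0 {zero}  _   = ≈-refl
  ∑-0 {suc m} f≈0 = ≈-trans (+-cong (f≈0 zero) (∑-0 (f≈0 ∘ suc))) (+-identityˡ 0#)

  ∑-neg : ∀ {m} (f : Fin m → Carrier) → ∑ R (λ i → - f i) ≈ - ∑ R f
  ∑-neg {zero}  _ = ≈-sym -0#≈0#
  ∑-neg {suc m} f = ≈-trans (+-congˡ (∑-neg (f ∘ suc))) (-‿+-comm (f zero) _)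

  ∑-sub : ∀ {m} (f g : Fin m → Carrier) → ∑ R (λ i → f i - g i) ≈ ∑ R f - ∑ R g
  ∑-sub {zero}  _ _ = ≈-sym (≈-trans (+-congˡ -0#≈0#) (+-identityʳ 0#))
  ∑-sub {suc m} f g = ≈-trans (+-congˡ (∑-sub (f ∘ suc) (g ∘ suc))) (interchange _ _ _ _)
    where
    interchange : ∀ a b c d → (a - b) +ᴿ (c - d) ≈ (a +ᴿ c) - (b +ᴿ d)
    interchange = solve 4 (λ a b c d → ((a ⊕ (⊝ b)) ⊕ (c ⊕ (⊝ d))) ⊜ ((a ⊕ c) ⊕ (⊝ (b ⊕ d)))) ≈-refl

  δ : ∀ {m} → Fin m → Fin m → Carrier
  δ zero    zero    = 1#
  δ zero    (suc _) = 0#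
  δ (suc _) zero    = 0#
  δ (suc i) (suc l) = δ i l

  δ-diag : ∀ {m} (i : Fin m) → δ i i ≡ 1#
  δ-diag zero    = refl
  δ-diag (suc i) = δ-diag i

  δ-off : ∀ {m} {i l : Fin m} → i ≢ l → δ i l ≡ 0#
  δ-off {i = zero}  {zero}  i≢l = contradiction refl i≢l
  δ-off {i = zero}  {suc _} _   = refl
  δ-off {i = suc _} {zero}  _   = refl
  δ-off {i = suc i} {suc l} i≢l = δ-off (i≢l ∘ cong suc)

  ∑-δ : ∀ {m} (i : Fin m) (v : Fin m → Carrier) → ∑ R (λ l → δ i l *ᴿ v l) ≈ v i
  ∑-δ zero    v = ≈-trans (+-cong (*-identityˡ (v zero)) (∑-0 (λ l → zeroˡ (v (suc l))))) (+-identityʳ (v zero))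
  ∑-δ (suc i) v = ≈-trans (+-cong (zeroˡ (v zero)) (∑-δ i (v ∘ suc))) (+-identityˡ (v (suc i)))

  -- LinIndep is the instance J = Fin n, and LinIndepᴹ is, up to currying, J = Fin n × Fin n.
  Independent : ∀ {r} {J : Set} → (Fin r → J → Carrier) → Set (c ⊔ ℓ)
  Independent {r} v = ∀ (a : Fin r → Carrier) → (∀ j → ∑ R (λ l → a l *ᴿ v l j) ≈ 0#) → ∀ l → a l ≈ 0#

  independent-cancel : ∀ {r} {J : Set} {v : Fin r → J → Carrier} → Independent v → ∀ {a a' : Fin r → Carrier} →
    (∀ j → ∑ R (λ l → a l *ᴿ v l j) ≈ ∑ R (λ l → a' l *ᴿ v l j)) → ∀ l → a l ≈ a' l
  independent-cancel {v = v} ind {a} {a'} same l = x∙y⁻¹≈ε⇒x≈y _ _ (ind (λ l → a l - a' l) difference l)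
    where
    difference : ∀ j → ∑ R (λ l → (a l - a' l) *ᴿ v l j) ≈ 0#
    difference j = ≈-trans (∑-cong (λ l → [y-z]x≈yx-zx (v l j) (a l) (a' l)))
                         (≈-trans (∑-sub (λ l → a l *ᴿ v l j) (λ l → a' l *ᴿ v l j)) (x≈y⇒x∙y⁻¹≈ε (same j)))

  comb-injective : ∀ {k n} {B : Fin k → Matrix R n} → LinIndepᴹ R B → ∀ {a a' : Fin k → Carrier} →
    MatEq R (comb R B a) (comb R B a') → ∀ l → a l ≈ a' l
  comb-injective {B = B} lin {a} {a'} same =
    independent-cancel {v = uncurry ∘ B} (λ a h → lin a (λ i j → h (i , j))) {a} {a'} (uncurry same)

  comb-isAlternating : ∀ {k n} {B : Fin k → Matrix R n} → (∀ l → IsAlternating R (B l)) →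
    ∀ a → IsAlternating R (comb R B a)
  comb-isAlternating {B = B} alt a =
    (λ i j → ≈-trans (∑-cong (λ l → ≈-trans (*-congˡ (proj₁ (alt l) i j)) (≈-sym (-‿distribʳ-* (a l) _))))
                   (∑-neg (λ l → a l *ᴿ B l j i))) ,
    (λ i → ∑-0 (λ l → ≈-trans (*-congˡ (proj₂ (alt l) i)) (zeroʳ (a l))))

  -ᴹ-isAlternating : ∀ {n} {A A' : Matrix R n} → IsAlternating R A → IsAlternating R A' →
    IsAlternating R (_-ᴹ_ R A A')
  -ᴹ-isAlternating {A = A} {A'} (A-anti , A-diag) (A'-anti , A'-diag) =
    (λ i j → ≈-trans (+-cong (A-anti i j) (-‿cong (A'-anti i j))) (-‿+-comm (A j i) (- A' j i))) ,
    (λ i → x≈y⇒x∙y⁻¹≈ε (≈-trans (A-diag i) (≈-sym (A'-diag i))))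

  RowsVanishFrom : ∀ {n} → Matrix R n → ℕ → Set ℓ
  RowsVanishFrom D s = ∀ i j → s ≤ toℕ i → D i j ≈ 0#

  rowsVanishFrom-size : ∀ {n} (D : Matrix R n) → RowsVanishFrom D n
  rowsVanishFrom-size D i _ n≤i = contradiction n≤i (ℕₚ.<⇒≱ (Finₚ.toℕ<n i))

  isAlternating⇒rowsVanishFrom : ∀ {n s} {D : Matrix R n} → IsAlternating R D →
    (∀ i j → toℕ i < toℕ j → s ≤ toℕ j → D i j ≈ 0#) → RowsVanishFrom D s
  isAlternating⇒rowsVanishFrom {D = D} (anti , diag) upper i j s≤i with ℕₚ.<-cmp (toℕ i) (toℕ j)
  ... | tri< i<j _ _ = upper i j i<j (ℕₚ.≤-trans s≤i (ℕₚ.<⇒≤ i<j))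
  ... | tri≈ _ i≡j _ = subst (λ j → D i j ≈ 0#) (Finₚ.toℕ-injective i≡j) (diag i)
  ... | tri> _ _ j<i = ≈-trans (anti i j) (≈-trans (-‿cong (upper j i j<i s≤i)) -0#≈0#)

  puncture : ∀ {k n} → (Fin k → Matrix R n) → (s : ℕ) → (Fin k → Carrier) → Fin (outerSize s n) → Carrier
  puncture {n = n} B s a = uncurry (comb R B a) ∘ outerPosition s n

  module _ (1≉0 : ¬ 1# ≈ 0#) where

    independent-nonzero : ∀ {r} {J : Set} {v : Fin r → J → Carrier} → Independent v →
      ∀ i → ¬ (∀ j → v i j ≈ 0#)
    independent-nonzero {v = v} ind i vᵢ≈0 =
      1≉0 (≈-trans (≈-sym (reflexive (δ-diag i))) (ind (δ i) (λ j → ≈-trans (∑-δ i (λ l → v l j)) (vᵢ≈0 j)) i))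

    independent-injective : ∀ {r} {J : Set} {v : Fin r → J → Carrier} → Independent v →
      ∀ {i i'} → (∀ j → v i j ≈ v i' j) → i ≡ i'
    independent-injective {v = v} ind {i} {i'} same with i Finₚ.≟ i'
    ... | yes i≡i' = i≡i'
    ... | no  i≢i' = ⊥-elim (1≉0 (begin
      1#       ≡⟨ sym (δ-diag i) ⟩
      δ i i    ≈⟨ independent-cancel ind (λ j → ≈-trans (∑-δ i (λ l → v l j))
                    (≈-trans (same j) (≈-sym (∑-δ i' (λ l → v l j))))) i ⟩
      δ i' i   ≡⟨ δ-off (i≢i' ∘ sym) ⟩
      0#       ∎))
      where open import Relation.Binary.Reasoning.Setoid setoid

    independentRows-≤ : ∀ {n r s} (D : Matrix R n) → RowsVanishFrom D s →
      (σ : Fin r → Fin n) → LinIndep R (D ∘ σ) → r ≤ s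
    independentRows-≤ {s = s} D vanish σ ind = Finₚ.injective⇒≤ {f = τ} τ-injective
      where
      row<s : ∀ i → toℕ (σ i) < s
      row<s i = ℕₚ.≰⇒> (λ s≤σi → independent-nonzero ind i (λ j → vanish (σ i) j s≤σi))
      τ : Fin _ → Fin s
      τ i = fromℕ< (row<s i)
      τ-injective : ∀ {i i'} → τ i ≡ τ i' → i ≡ i'
      τ-injective {i} {i'} τi≡τi' = independent-injective ind (λ j → reflexive (cong (λ x → D x j) σi≡σi'))
        where
        σi≡σi' : σ i ≡ σ i'
        σi≡σi' = Finₚ.toℕ-injective (Finₚ.fromℕ<-injective _ _ (row<s i) (row<s i') τi≡τi')

    rank-≤ : ∀ {n r s} (D : Matrix R n) → RowsVanishFrom D s → HasRank R D r → r ≤ s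
    rank-≤ D vanish ((σ , ind) , _) = independentRows-≤ D vanish σ ind

    rank-≤-size : ∀ {n r} (D : Matrix R n) → HasRank R D r → r ≤ n
    rank-≤-size D = rank-≤ D (rowsVanishFrom-size D)

    -- Having a rank asserts an exact maximum, which over a general field exists only classically.
    ¬¬hasRank : ∀ {n} (D : Matrix R n) → ¬ ¬ ∃ (HasRank R D)
    ¬¬hasRank {n} D = search (suc n) (λ (σ , ind) → ℕₚ.1+n≰n (independentRows-≤ D (rowsVanishFrom-size D) σ ind))
      where
      IndependentRows : ℕ → Set _
      IndependentRows r = ∃ λ (σ : Fin r → Fin n) → LinIndep R (D ∘ σ)
      search : ∀ m → ¬ IndependentRows m → ¬ ¬ ∃ (HasRank R D)
      search zero    none = contradiction ((λ ()) , λ _ _ ()) none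
      search (suc m) none noRank = ¬¬-excluded-middle λ
        { (yes rows) → noRank (m , rows , λ σ ind → none (σ , ind))
        ; (no none′) → search m none′ noRank }

    minRankDistance-rowsVanish : ∀ {k n d} {B : Fin k → Matrix R n} → MinRankDistance R B (2 * d) →
      ∀ {A A'} → InSpan R B A → InSpan R B A' → RowsVanishFrom (_-ᴹ_ R A A') (2 * d ∸ 1) →
      ¬ ¬ MatEq R A A'
    minRankDistance-rowsVanish {d = zero} _ _ _ vanish A≉A' =
      A≉A' (λ i j → x∙y⁻¹≈ε⇒x≈y _ _ (vanish i j z≤n))
    minRankDistance-rowsVanish {d = suc d} (separated , _) {A} {A'} A∈C A'∈C vanish A≉A' =
      ¬¬hasRank (_-ᴹ_ R A A') λ (r , rank) →
        ℕₚ.1+n≰n (ℕₚ.m≤pred[n]⇒suc[m]≤n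
          (ℕₚ.≤-trans (separated _ _ A∈C A'∈C A≉A' r rank) (rank-≤ (_-ᴹ_ R A A') vanish rank)))

    minRankDistance-≤ : ∀ {k n δ} {B : Fin k → Matrix R n} → MinRankDistance R B δ → δ ≤ n
    minRankDistance-≤ (_ , A , A' , _ , _ , _ , rank) = rank-≤-size (_-ᴹ_ R A A') rank

    puncture-injective : ∀ {k n d} {B : Fin k → Matrix R n} → (∀ l → IsAlternating R (B l)) →
      LinIndepᴹ R B → MinRankDistance R B (2 * d) → ∀ a a' →
      (∀ p → puncture B (2 * d ∸ 1) a p ≈ puncture B (2 * d ∸ 1) a' p) → ¬ ¬ (∀ l → a l ≈ a' l)
    puncture-injective {n = n} {d} {B} alt lin mrd a a' agree =
      ¬¬-map (comb-injective lin) (minRankDistance-rowsVanish {d = d} mrd (a , λ _ _ → ≈-refl) (a' , λ _ _ → ≈-refl) vanish)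
      where
      A-A' : Matrix R n
      A-A' = _-ᴹ_ R (comb R B a) (comb R B a')
      upper : ∀ i j → toℕ i < toℕ j → 2 * d ∸ 1 ≤ toℕ j → A-A' i j ≈ 0#
      upper i j i<j s≤j with outerPosition-surjective (2 * d ∸ 1) n i j i<j s≤j
      ... | p , pᵢⱼ = subst (λ ij → uncurry A-A' ij ≈ 0#) pᵢⱼ (x≈y⇒x∙y⁻¹≈ε (agree p))
      vanish : RowsVanishFrom A-A' (2 * d ∸ 1)
      vanish = isAlternating⇒rowsVanishFrom
        (-ᴹ-isAlternating (comb-isAlternating alt a) (comb-isAlternating alt a')) upper

  module _ {q} (card : HasCardinality R q) where
    private
      element : Fin q → Carrier
      element = proj₁ card
      index : Carrier → Fin q
      index x = proj₁ (proj₁ (proj₂ card) x)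
      element-index : ∀ x → element (index x) ≈ x
      element-index x = proj₂ (proj₁ (proj₂ card) x)
      element-injective : ∀ {i j} → element i ≈ element j → i ≡ j
      element-injective = proj₂ (proj₂ card) _ _

    encode : ∀ {y} → (Fin y → Carrier) → Fin (q ^ y)
    encode v = funToFin (index ∘ v)

    decode : ∀ {x} → Fin (q ^ x) → Fin x → Carrier
    decode t = element ∘ finToFun t

    encode-injective : ∀ {y} {v w : Fin y → Carrier} → encode v ≡ encode w → ∀ j → v j ≈ w j
    encode-injective {v = v} {w} v≡w j = begin
      v j                    ≈⟨ element-index (v j) ⟨
      element (index (v j))  ≡⟨ cong element index-agrees ⟩
      element (index (w j))  ≈⟨ element-index (w j) ⟩
      w j                    ∎
      where
      open import Relation.Binary.Reasoning.Setoid setoid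
      index-agrees : index (v j) ≡ index (w j)
      index-agrees = trans (sym (Finₚ.finToFun-funToFin (index ∘ v) j))
        (trans (cong (λ t → finToFun t j) v≡w) (Finₚ.finToFun-funToFin (index ∘ w) j))

    decode-injective : ∀ {x} {t t' : Fin (q ^ x)} → (∀ i → decode t i ≈ decode t' i) → t ≡ t'
    decode-injective {x} {t} {t'} same = begin
      t                               ≡⟨ sym (Finₚ.funToFin-finToFin {x} {q} t) ⟩
      funToFin (finToFun {q} {x} t)   ≡⟨ funToFin-cong {x} {q} (element-injective ∘ same) ⟩
      funToFin (finToFun {q} {x} t')  ≡⟨ Finₚ.funToFin-finToFin {x} {q} t' ⟩
      t'                              ∎
      where open ≡-Reasoning

    ¬¬injective⇒^≤ : ∀ {x y} (f : (Fin x → Carrier) → (Fin y → Carrier)) →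
      (∀ g g' → (∀ j → f g j ≈ f g' j) → ¬ ¬ (∀ i → g i ≈ g' i)) → q ^ x ≤ q ^ y
    ¬¬injective⇒^≤ {x} f f-injective = Finₚ.injective⇒≤ {f = encode ∘ f ∘ decode} λ {t} {t'} same →
      decidable-stable (t Finₚ.≟ t') (¬¬-map (decode-injective {x}) (f-injective _ _ (encode-injective same)))

corollary4p4 : ∀ {c ℓ : Level} (R : CommutativeRing c ℓ) → IsField R →
    (q : ℕ) → IsPrimePower q → HasCardinality R q →
    (n k d : ℕ) (B : Fin k → Matrix R n) →
    (∀ l → IsAlternating R (B l)) → LinIndepᴹ R B →
    MinRankDistance R B (2 * d) →
    2 * k + 2 * ((d ∸ 1) * (2 * d ∸ 1)) ≤ n * (n ∸ 1)
corollary4p4 R R-field q q-primePower card n k d B alt lin mrd = begin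
  2 * k + 2 * ((d ∸ 1) * (2 * d ∸ 1))  ≤⟨ ℕₚ.+-monoˡ-≤ _ (ℕₚ.*-monoʳ-≤ 2 k≤outerSize) ⟩
  2 * outerSize s n + 2 * ((d ∸ 1) * (2 * d ∸ 1))
                                       ≡⟨ cong (λ t → 2 * outerSize s n + 2 * t) (triangle-odd d) ⟩
  2 * outerSize s n + 2 * triangle s   ≡⟨ sym (ℕₚ.*-distribˡ-+ 2 (outerSize s n) (triangle s)) ⟩
  2 * (outerSize s n + triangle s)     ≡⟨ cong (2 *_) (outerSize+triangle s≤n) ⟩
  2 * triangle n                       ≡⟨ 2*triangle n ⟩
  n * (n ∸ 1)                          ∎
  where
  open ℕₚ.≤-Reasoning
  open IsField R-field using (1≉0)
  s : ℕ
  s = 2 * d ∸ 1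
  s≤n : s ≤ n
  s≤n = ℕₚ.≤-trans (ℕₚ.m∸n≤m (2 * d) 1) (minRankDistance-≤ R 1≉0 mrd)
  k≤outerSize : k ≤ outerSize s n
  k≤outerSize = ^-cancelˡ-≤ (primePower>1 q-primePower)
    (¬¬injective⇒^≤ R card (puncture R B s) (puncture-injective R 1≉0 {d = d} alt lin mrd))
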